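{- Let $d\ge0$ and $m=2^d$. There are exactly $2^{2m-1}$ distinct (as words) $(m,m)$-affine necklaces. More precisely, the affine necklaces obtained from distinct pairs $(M,z)$, with $M$ a matrix $M_d^{n_1,\dots,n_m}$ and $z$ a binary word of length $m$, are distinct words.
   Context: Words are over $\mathbb{F}_2=\{0,1\}$; a word $a_1\cdots a_n$ is identified with the column vector $(a_1,\dots,a_n)^t$; $\oplus$ is componentwise addition mod $2$. Matrices: $M_0=(1)$, $M_{d+1}=\begin{pmatrix}M_d&M_d\\0&M_d\end{pmatrix}$ over $\mathbb{F}_2$. Let $\sigma$ map $a_1\cdots a_n$ to $a_na_1\cdots a_{n-1}$ (also on column vectors). For integers $n_1,\dots,n_m$ with $n_m=0$ and $n_{i+1}\le n_i\le n_{i+1}+1$ ($1\le i<m$), and $C_1,\dots,C_m$ the columns of $M_d$, set $M_d^{n_1,\dots,n_m}=(\sigma^{n_1}(C_1),\dots,\sigma^{n_m}(C_m))$. Let $w_1,\dots,w_{2^m}$ be all binary words of length $m$ in lexicographic order. The $(m,m)$-affine necklace obtained from $(M,z)$, where $M$ is some $M_d^{n_1,\dots,n_m}$ and $z$ a binary word of length $m$, is the word $(Mw'_1)(Mw'_2)\cdots(Mw'_{2^m})$ with $w'_i=w_i\oplus z$. -}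

module Defs where

open import Data.Bool using (Bool; true; false; if_then_else_; _xor_)
open import Data.Nat using (ℕ; zero; suc; _+_; _^_; _≤_)
open import Data.Nat.Properties using (+-identityʳ)
open import Data.List using (List; []; _∷_; _++_; map; concatMap)
open import Data.Vec using (Vec; []; _∷_; cast; replicate; zipWith; init; last; toList)
  renaming (_++_ to _++ᵛ_; map to mapᵛ)
open import Data.Product using (Σ; _×_; _,_)
open import Data.Unit using (⊤)
open import Relation.Binary.PropositionalEquality using (_≡_; cong; sym)

-- Words over F₂ = Bool (false = 0, true = 1), ⊕ = componentwise xor.
_⊕_ : ∀ {n} → Vec Bool n → Vec Bool n → Vec Bool n
_⊕_ = zipWith _xor_

private
  dbl : ∀ d → 2 ^ d + 2 ^ d ≡ 2 ^ suc d
  dbl d = cong (2 ^ d +_) (sym (+-identityʳ (2 ^ d)))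

-- Columns of M_d (a 2^d × 2^d matrix over F₂), listed left to right.
-- M_0 = (1),  M_{d+1} = [[M_d, M_d],[0, M_d]]:
-- the first 2^d columns of M_{d+1} are C ++ 0, the last 2^d are C ++ C.
Mcols : (d : ℕ) → Vec (Vec Bool (2 ^ d)) (2 ^ d)
Mcols zero = (true ∷ []) ∷ []
Mcols (suc d) =
  cast (dbl d)
    (mapᵛ (λ c → cast (dbl d) (c ++ᵛ replicate (2 ^ d) false)) (Mcols d)
     ++ᵛ mapᵛ (λ c → cast (dbl d) (c ++ᵛ c)) (Mcols d))

σ : ∀ {A : Set} {n} → Vec A n → Vec A n
σ [] = []
σ (x ∷ xs) = last (x ∷ xs) ∷ init (x ∷ xs)

σ^ : ∀ {A : Set} {n} → ℕ → Vec A n → Vec A n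
σ^ zero v = v
σ^ (suc k) v = σ (σ^ k v)

Mshift : (d : ℕ) → Vec ℕ (2 ^ d) → Vec (Vec Bool (2 ^ d)) (2 ^ d)
Mshift d ns = zipWith σ^ ns (Mcols d)

Admissible : ∀ {m} → Vec ℕ m → Set
Admissible [] = ⊤
Admissible (x ∷ []) = x ≡ 0
Admissible (x ∷ y ∷ xs) = (y ≤ x × x ≤ suc y) × Admissible (y ∷ xs)

mulMV : ∀ {k m} → Vec (Vec Bool k) m → Vec Bool m → Vec Bool k
mulMV {k} [] [] = replicate k false
mulMV (c ∷ cs) (b ∷ bs) = if b then c ⊕ mulMV cs bs else mulMV cs bs

allWords : (m : ℕ) → List (Vec Bool m)
allWords zero = [] ∷ []
allWords (suc m) = map (false ∷_) (allWords m) ++ map (true ∷_) (allWords m)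

necklace : ∀ {k m} → Vec (Vec Bool k) m → Vec Bool m → List Bool
necklace {m = m} M z = concatMap (λ w → toList (mulMV M (w ⊕ z))) (allWords m)

IsAffineNecklace : ℕ → List Bool → Set
IsAffineNecklace d w =
  Σ (Vec ℕ (2 ^ d)) λ ns → Σ (Vec Bool (2 ^ d)) λ z →
    Admissible ns × necklace (Mshift d ns) z ≡ w

-- Let Δ x = x ⊕ σ x, i.e. multiplication by 1 + t in 𝔽₂[t]/(t^n − 1). A column of M_d followed by
-- t further columns satisfies Δ^t c = 1⋯1 (hence Δ^(t+1) c = 0); this triangularity passes from M_d
-- to M_(d+1) by the Frobenius identity Δ^(2^d) = 1 + σ^(2^d), and survives the shifts because σ commutes
-- with Δ and fixes 1⋯1. So every M = M_d^(n_1,…,n_m) is injective. A necklace lists the affine map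
-- w ↦ M (w ⊕ z) on all words, which determines M and then z. The shifts are read off M: column i
-- starts with a 1 and ends in m − i zeros, and admissibility gives n_i ≤ m − i, so n_i is the number
-- of leading zeros of σ^(n_i) C_i. Admissible sequences correspond to bit words of length m − 1,
-- which gives 2^(m−1) · 2^m necklaces.
module Submission where

open import Data.Bool using (Bool; true; false; _xor_; if_then_else_)
open import Data.Bool.Properties
  using (xor-comm; xor-assoc; xor-identityˡ; xor-identityʳ; xor-same;
         not-distribˡ-xor; not-distribʳ-xor; xor-annihilates-not)
open import Data.Nat using (ℕ; zero; suc; _+_; _*_; _∸_; _^_; _≤_; z≤n; s≤s; NonZero)
open import Data.Nat.Properties
  using (+-comm; +-identityʳ; ≤-refl; ≤-trans; ≤-antisym; n≤1+n; 1+n≢n; m≤n⇒m<n∨m≡n; m+[n∸m]≡n;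
         m^n≢0; ^-distribˡ-+-*)
open import Data.List using (List; []; _∷_; _++_; [_]; _∷ʳ_; length; cartesianProductWith)
import Data.List as List
import Data.List.Properties as List
open import Data.Vec using (Vec; []; _∷_; toList; zipWith; initLast)
  renaming (_++_ to _++ᵛ_; _∷ʳ_ to _∷ʳᵛ_)
import Data.Vec as Vec
import Data.Vec.Properties as Vec
open import Data.Vec.Relation.Binary.Equality.Cast using (cast-is-id)
open import Data.List.Relation.Unary.Any using (here; there)
open import Data.List.Membership.Propositional using (_∈_)
open import Data.List.Membership.Propositional.Properties
  using (∈-++⁺ˡ; ∈-++⁺ʳ; ∈-map⁺; ∈-map⁻; ∈-cartesianProductWith⁺; ∈-cartesianProductWith⁻)
open import Data.List.Relation.Unary.All using ([])
open import Data.List.Relation.Unary.Unique.Propositional using (Unique; []; _∷_)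
import Data.List.Relation.Unary.Unique.Propositional.Properties as Unique
open import Data.List.Relation.Binary.Disjoint.Propositional using (Disjoint)
open import Data.Product using (Σ; _×_; _,_; proj₁; proj₂)
open import Data.Sum using (inj₁; inj₂)
open import Data.Unit using (⊤; tt)
open import Function using (_∘_; _⇔_; mk⇔)
open import Relation.Nullary using (contradiction)
open import Relation.Binary.PropositionalEquality
  using (_≡_; refl; sym; trans; cong; cong₂; subst; module ≡-Reasoning)
open ≡-Reasoning

open import Defs

module _ {A : Set} where

  toList-injective : ∀ {n} (u v : Vec A n) → toList u ≡ toList v → u ≡ v
  toList-injective u v e = trans (sym (cast-is-id refl u)) (Vec.toList-injective refl u v e)

  ++-replicateᵛ : ∀ a b (x : A) → Vec.replicate a x ++ᵛ Vec.replicate b x ≡ Vec.replicate (a + b) x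
  ++-replicateᵛ zero b x = refl
  ++-replicateᵛ (suc a) b x = cong (x ∷_) (++-replicateᵛ a b x)

  ++-replicate : ∀ a b (x : A) → List.replicate a x ++ List.replicate b x ≡ List.replicate (a + b) x
  ++-replicate zero b x = refl
  ++-replicate (suc a) b x = cong (x ∷_) (++-replicate a b x)

zeros ones : ∀ n → Vec Bool n
zeros n = Vec.replicate n false
ones n = Vec.replicate n true

module _ {n : ℕ} where

  ⊕-comm : (x y : Vec Bool n) → x ⊕ y ≡ y ⊕ x
  ⊕-comm = Vec.zipWith-comm xor-comm

  ⊕-assoc : (x y z : Vec Bool n) → (x ⊕ y) ⊕ z ≡ x ⊕ (y ⊕ z)
  ⊕-assoc = Vec.zipWith-assoc xor-assoc

  ⊕-identityˡ : (x : Vec Bool n) → zeros n ⊕ x ≡ x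
  ⊕-identityˡ = Vec.zipWith-identityˡ xor-identityˡ

  ⊕-identityʳ : (x : Vec Bool n) → x ⊕ zeros n ≡ x
  ⊕-identityʳ = Vec.zipWith-identityʳ xor-identityʳ

⊕-self : ∀ {n} (x : Vec Bool n) → x ⊕ x ≡ zeros n
⊕-self [] = refl
⊕-self (a ∷ x) = cong₂ _∷_ (xor-same a) (⊕-self x)

⊕-interchange : ∀ {n} (a b c d : Vec Bool n) → (a ⊕ b) ⊕ (c ⊕ d) ≡ (a ⊕ c) ⊕ (b ⊕ d)
⊕-interchange [] [] [] [] = refl
⊕-interchange (a ∷ as) (b ∷ bs) (c ∷ cs) (d ∷ ds) =
  cong₂ _∷_ (xor-interchange a b c d) (⊕-interchange as bs cs ds)
  where
  xor-interchange : ∀ a b c d → (a xor b) xor (c xor d) ≡ (a xor c) xor (b xor d)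
  xor-interchange false false c d = refl
  xor-interchange false true c d = not-distribʳ-xor c d
  xor-interchange true false c d = not-distribˡ-xor c d
  xor-interchange true true c d = sym (xor-annihilates-not c d)

module _ {n : ℕ} where

  ⊕-involutiveʳ : (x y : Vec Bool n) → (x ⊕ y) ⊕ y ≡ x
  ⊕-involutiveʳ x y = begin
    (x ⊕ y) ⊕ y   ≡⟨ ⊕-assoc x y y ⟩
    x ⊕ (y ⊕ y)   ≡⟨ cong (x ⊕_) (⊕-self y) ⟩
    x ⊕ zeros n   ≡⟨ ⊕-identityʳ x ⟩
    x             ∎

  ⊕-cancelʳ : (x y z : Vec Bool n) → x ⊕ z ≡ y ⊕ z → x ≡ y
  ⊕-cancelʳ x y z e = begin
    x             ≡⟨ ⊕-involutiveʳ x z ⟨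
    (x ⊕ z) ⊕ z   ≡⟨ cong (_⊕ z) e ⟩
    (y ⊕ z) ⊕ z   ≡⟨ ⊕-involutiveʳ y z ⟩
    y             ∎

  ⊕≡zeros⇒≡ : (x y : Vec Bool n) → x ⊕ y ≡ zeros n → x ≡ y
  ⊕≡zeros⇒≡ x y e = ⊕-cancelʳ x y y (trans e (sym (⊕-self y)))

  ⊕-cancel-middle : (a b c : Vec Bool n) → (a ⊕ b) ⊕ (b ⊕ c) ≡ a ⊕ c
  ⊕-cancel-middle a b c = begin
    (a ⊕ b) ⊕ (b ⊕ c)   ≡⟨ ⊕-assoc a b (b ⊕ c) ⟩
    a ⊕ (b ⊕ (b ⊕ c))   ≡⟨ cong (a ⊕_) (⊕-assoc b b c) ⟨
    a ⊕ ((b ⊕ b) ⊕ c)   ≡⟨ cong (λ u → a ⊕ (u ⊕ c)) (⊕-self b) ⟩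
    a ⊕ (zeros n ⊕ c)   ≡⟨ cong (a ⊕_) (⊕-identityˡ c) ⟩
    a ⊕ c               ∎

⊕-∷ʳ : ∀ {n} (xs ys : Vec Bool n) a b → (xs ∷ʳᵛ a) ⊕ (ys ∷ʳᵛ b) ≡ (xs ⊕ ys) ∷ʳᵛ (a xor b)
⊕-∷ʳ [] [] a b = refl
⊕-∷ʳ (x ∷ xs) (y ∷ ys) a b = cong ((x xor y) ∷_) (⊕-∷ʳ xs ys a b)

module _ {A : Set} where

  σ-∷ʳ : ∀ {n} (xs : Vec A n) x → σ (xs ∷ʳᵛ x) ≡ x ∷ xs
  σ-∷ʳ [] x = refl
  σ-∷ʳ (y ∷ ys) x = cong₂ _∷_ (Vec.last-∷ʳ x (y ∷ ys)) (Vec.init-∷ʳ x (y ∷ ys))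

  toList-σ : ∀ {n} (v : Vec A n) {l x} → toList v ≡ l ∷ʳ x → toList (σ v) ≡ x ∷ l
  toList-σ [] {[]} ()
  toList-σ [] {_ ∷ _} ()
  toList-σ {suc n} v e with initLast v
  ... | vs , a , refl with List.∷ʳ-injective (toList vs) _ (trans (sym (Vec.toList-∷ʳ a vs)) e)
  ...   | refl , refl = cong toList (σ-∷ʳ vs a)

  toList-σ^ : ∀ {n} (v : Vec A n) xs ys → toList v ≡ xs ++ ys → toList (σ^ (length ys) v) ≡ ys ++ xs
  toList-σ^ v xs [] e = trans e (List.++-identityʳ xs)
  toList-σ^ v xs (y ∷ ys) e = toList-σ (σ^ (length ys) v) (begin
    toList (σ^ (length ys) v)   ≡⟨ toList-σ^ v (xs ∷ʳ y) ys (trans e (sym (List.++-assoc xs [ y ] ys))) ⟩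
    ys ++ xs ∷ʳ y               ≡⟨ List.++-assoc ys xs [ y ] ⟨
    (ys ++ xs) ∷ʳ y             ∎)

  σ^-++ : ∀ {n} (x y : Vec A n) → σ^ n (x ++ᵛ y) ≡ y ++ᵛ x
  σ^-++ {n} x y = toList-injective _ _ (begin
    toList (σ^ n (x ++ᵛ y))               ≡⟨ cong (λ k → toList (σ^ k (x ++ᵛ y))) (Vec.length-toList y) ⟨
    toList (σ^ (length (toList y)) (x ++ᵛ y)) ≡⟨ toList-σ^ (x ++ᵛ y) (toList x) (toList y) (Vec.toList-++ x y) ⟩
    toList y ++ toList x                  ≡⟨ Vec.toList-++ y x ⟨
    toList (y ++ᵛ x)                      ∎)

  σ-++-self : ∀ {n} (x : Vec A n) → σ (x ++ᵛ x) ≡ σ x ++ᵛ σ x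
  σ-++-self {zero} [] = refl
  σ-++-self {suc n} x with initLast x
  ... | xs , a , refl = toList-injective _ _ (begin
    toList (σ (x′ ++ᵛ x′))            ≡⟨ toList-σ (x′ ++ᵛ x′) split ⟩
    a ∷ ((l ∷ʳ a) ++ l)               ≡⟨ cong (a ∷_) (List.++-assoc l [ a ] l) ⟩
    (a ∷ l) ++ (a ∷ l)                ≡⟨ Vec.toList-++ (a ∷ xs) (a ∷ xs) ⟨
    toList ((a ∷ xs) ++ᵛ (a ∷ xs))    ≡⟨ cong (λ u → toList (u ++ᵛ u)) (σ-∷ʳ xs a) ⟨
    toList (σ x′ ++ᵛ σ x′)            ∎)
    where
    x′ = xs ∷ʳᵛ a
    l = toList xs
    split : toList (x′ ++ᵛ x′) ≡ ((l ∷ʳ a) ++ l) ∷ʳ a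
    split = begin
      toList (x′ ++ᵛ x′)           ≡⟨ Vec.toList-++ x′ x′ ⟩
      toList x′ ++ toList x′       ≡⟨ cong (λ l′ → l′ ++ l′) (Vec.toList-∷ʳ a xs) ⟩
      (l ∷ʳ a) ++ (l ∷ʳ a)         ≡⟨ List.++-assoc (l ∷ʳ a) l [ a ] ⟨
      ((l ∷ʳ a) ++ l) ∷ʳ a         ∎

  σ-replicate : ∀ n (a : A) → σ (Vec.replicate n a) ≡ Vec.replicate n a
  σ-replicate zero a = refl
  σ-replicate (suc n) a = trans (cong σ (replicate-∷ʳ n)) (σ-∷ʳ (Vec.replicate n a) a)
    where
    replicate-∷ʳ : ∀ n → Vec.replicate (suc n) a ≡ Vec.replicate n a ∷ʳᵛ a
    replicate-∷ʳ zero = refl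
    replicate-∷ʳ (suc n) = cong (a ∷_) (replicate-∷ʳ n)

  σ^-replicate : ∀ k n (a : A) → σ^ k (Vec.replicate n a) ≡ Vec.replicate n a
  σ^-replicate zero n a = refl
  σ^-replicate (suc k) n a = trans (cong σ (σ^-replicate k n a)) (σ-replicate n a)

  σ^-+ : ∀ {n} a b (x : Vec A n) → σ^ (a + b) x ≡ σ^ a (σ^ b x)
  σ^-+ zero b x = refl
  σ^-+ (suc a) b x = cong σ (σ^-+ a b x)

  σ^-σ : ∀ {n} a (x : Vec A n) → σ^ a (σ x) ≡ σ (σ^ a x)
  σ^-σ a x = trans (sym (σ^-+ a 1 x)) (cong (λ k → σ^ k x) (+-comm a 1))

σ-⊕ : ∀ {n} (x y : Vec Bool n) → σ (x ⊕ y) ≡ σ x ⊕ σ y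
σ-⊕ {zero} [] [] = refl
σ-⊕ {suc n} x y with initLast x | initLast y
... | xs , a , refl | ys , b , refl = begin
  σ ((xs ∷ʳᵛ a) ⊕ (ys ∷ʳᵛ b))       ≡⟨ cong σ (⊕-∷ʳ xs ys a b) ⟩
  σ ((xs ⊕ ys) ∷ʳᵛ (a xor b))       ≡⟨ σ-∷ʳ (xs ⊕ ys) (a xor b) ⟩
  (a ∷ xs) ⊕ (b ∷ ys)               ≡⟨ cong₂ _⊕_ (σ-∷ʳ xs a) (σ-∷ʳ ys b) ⟨
  σ (xs ∷ʳᵛ a) ⊕ σ (ys ∷ʳᵛ b)       ∎

σ^-⊕ : ∀ {n} k (x y : Vec Bool n) → σ^ k (x ⊕ y) ≡ σ^ k x ⊕ σ^ k y
σ^-⊕ zero x y = refl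
σ^-⊕ (suc k) x y = trans (cong σ (σ^-⊕ k x y)) (σ-⊕ (σ^ k x) (σ^ k y))

Δ : ∀ {n} → Vec Bool n → Vec Bool n
Δ x = x ⊕ σ x

Δ^ : ∀ {n} → ℕ → Vec Bool n → Vec Bool n
Δ^ zero x = x
Δ^ (suc k) x = Δ (Δ^ k x)

Δ-⊕ : ∀ {n} (x y : Vec Bool n) → Δ (x ⊕ y) ≡ Δ x ⊕ Δ y
Δ-⊕ x y = trans (cong ((x ⊕ y) ⊕_) (σ-⊕ x y)) (⊕-interchange x y (σ x) (σ y))

Δ^-⊕ : ∀ {n} k (x y : Vec Bool n) → Δ^ k (x ⊕ y) ≡ Δ^ k x ⊕ Δ^ k y
Δ^-⊕ zero x y = refl
Δ^-⊕ (suc k) x y = trans (cong Δ (Δ^-⊕ k x y)) (Δ-⊕ (Δ^ k x) (Δ^ k y))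

Δ-replicate : ∀ n a → Δ (Vec.replicate n a) ≡ zeros n
Δ-replicate n a = trans (cong (Vec.replicate n a ⊕_) (σ-replicate n a)) (⊕-self _)

Δ^-zeros : ∀ {n} k → Δ^ k (zeros n) ≡ zeros n
Δ^-zeros zero = refl
Δ^-zeros {n} (suc k) = trans (cong Δ (Δ^-zeros k)) (Δ-replicate n false)

Δ^-+ : ∀ {n} a b (x : Vec Bool n) → Δ^ (a + b) x ≡ Δ^ a (Δ^ b x)
Δ^-+ zero b x = refl
Δ^-+ (suc a) b x = cong Δ (Δ^-+ a b x)

σ^-Δ^ : ∀ {n} a k (x : Vec Bool n) → σ^ a (Δ^ k x) ≡ Δ^ k (σ^ a x)
σ^-Δ^ a zero x = refl
σ^-Δ^ a (suc k) x = begin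
  σ^ a (Δ y)              ≡⟨ σ^-⊕ a y (σ y) ⟩
  σ^ a y ⊕ σ^ a (σ y)     ≡⟨ cong (σ^ a y ⊕_) (σ^-σ a y) ⟩
  Δ (σ^ a y)              ≡⟨ cong Δ (σ^-Δ^ a k x) ⟩
  Δ (Δ^ k (σ^ a x))       ∎
  where y = Δ^ k x

-- Over 𝔽₂, (1 + t)^(2^e) = 1 + t^(2^e): squaring is additive.
Δ^-2^ : ∀ {n} e (x : Vec Bool n) → Δ^ (2 ^ e) x ≡ x ⊕ σ^ (2 ^ e) x
Δ^-2^ zero x = refl
Δ^-2^ (suc e) x = begin
  Δ^ (k + (k + 0)) x                          ≡⟨ cong (λ j → Δ^ (k + j) x) (+-identityʳ k) ⟩
  Δ^ (k + k) x                                ≡⟨ Δ^-+ k k x ⟩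
  Δ^ k (Δ^ k x)                               ≡⟨ Δ^-2^ e (Δ^ k x) ⟩
  Δ^ k x ⊕ σ^ k (Δ^ k x)                      ≡⟨ cong₂ (λ u v → u ⊕ σ^ k v) (Δ^-2^ e x) (Δ^-2^ e x) ⟩
  (x ⊕ σ^ k x) ⊕ σ^ k (x ⊕ σ^ k x)            ≡⟨ cong ((x ⊕ σ^ k x) ⊕_) (σ^-⊕ k x (σ^ k x)) ⟩
  (x ⊕ σ^ k x) ⊕ (σ^ k x ⊕ σ^ k (σ^ k x))     ≡⟨ ⊕-cancel-middle x (σ^ k x) (σ^ k (σ^ k x)) ⟩
  x ⊕ σ^ k (σ^ k x)                           ≡⟨ cong (x ⊕_) (σ^-+ k k x) ⟨
  x ⊕ σ^ (k + k) x                            ≡⟨ cong (λ j → x ⊕ σ^ (k + j) x) (+-identityʳ k) ⟨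
  x ⊕ σ^ (k + (k + 0)) x                      ∎
  where k = 2 ^ e

Δ^-halves : ∀ e (x y : Vec Bool (2 ^ e)) → Δ^ (2 ^ e) (x ++ᵛ y) ≡ (x ⊕ y) ++ᵛ (x ⊕ y)
Δ^-halves e x y = begin
  Δ^ (2 ^ e) (x ++ᵛ y)                  ≡⟨ Δ^-2^ e (x ++ᵛ y) ⟩
  (x ++ᵛ y) ⊕ σ^ (2 ^ e) (x ++ᵛ y)      ≡⟨ cong ((x ++ᵛ y) ⊕_) (σ^-++ x y) ⟩
  (x ++ᵛ y) ⊕ (y ++ᵛ x)                 ≡⟨ Vec.zipWith-++ _xor_ x y y x ⟩
  (x ⊕ y) ++ᵛ (y ⊕ x)                   ≡⟨ cong ((x ⊕ y) ++ᵛ_) (⊕-comm y x) ⟩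
  (x ⊕ y) ++ᵛ (x ⊕ y)                   ∎

Δ^-++-self : ∀ {n} k (x : Vec Bool n) → Δ^ k (x ++ᵛ x) ≡ Δ^ k x ++ᵛ Δ^ k x
Δ^-++-self zero x = refl
Δ^-++-self (suc k) x = begin
  Δ (Δ^ k (x ++ᵛ x))          ≡⟨ cong Δ (Δ^-++-self k x) ⟩
  Δ (y ++ᵛ y)                 ≡⟨ cong ((y ++ᵛ y) ⊕_) (σ-++-self y) ⟩
  (y ++ᵛ y) ⊕ (σ y ++ᵛ σ y)   ≡⟨ Vec.zipWith-++ _xor_ y y (σ y) (σ y) ⟩
  Δ y ++ᵛ Δ y                 ∎
  where y = Δ^ k x

-- P t c: the column c is followed by t further columns.
Columns : ∀ {n} → (ℕ → Vec Bool n → Set) → ∀ {m} → Vec (Vec Bool n) m → Set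
Columns P [] = ⊤
Columns P (_∷_ {t} c cs) = P t c × Columns P cs

Columns-++ : ∀ {n k m} {P : ℕ → Vec Bool n → Set} (xs : Vec (Vec Bool n) k) (ys : Vec (Vec Bool n) m) →
             Columns (λ t → P (t + m)) xs → Columns P ys → Columns P (xs ++ᵛ ys)
Columns-++ [] ys _ pys = pys
Columns-++ (x ∷ xs) ys (px , pxs) pys = px , Columns-++ xs ys pxs pys

module _ {n n′ : ℕ} {P : ℕ → Vec Bool n → Set} {Q : ℕ → Vec Bool n′ → Set} (f : Vec Bool n → Vec Bool n′) where

  Columns-map : (∀ t c → P t c → Q t (f c)) → ∀ {m} (cs : Vec (Vec Bool n) m) →
                Columns P cs → Columns Q (Vec.map f cs)
  Columns-map pf [] _ = tt
  Columns-map pf (_∷_ {t} c cs) (pc , pcs) = pf t c pc , Columns-map pf cs pcs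

-- Triangularity with respect to the filtration ker Δ ⊆ ker Δ² ⊆ ⋯.
Triangular : ∀ {n m} → Vec (Vec Bool n) m → Set
Triangular {n} = Columns (λ t c → Δ^ t c ≡ ones n)

HeadOneTrailingZeros : ∀ {n} → ℕ → Vec Bool n → Set
HeadOneTrailingZeros t c = Σ (List Bool) λ s → toList c ≡ true ∷ s ++ List.replicate t false

Triangular-σ^ : ∀ {n m} (ns : Vec ℕ m) (cs : Vec (Vec Bool n) m) → Triangular cs → Triangular (zipWith σ^ ns cs)
Triangular-σ^ [] [] _ = tt
Triangular-σ^ {n} (a ∷ ns) (_∷_ {t} c cs) (pc , pcs) =
  trans (sym (σ^-Δ^ a t c)) (trans (cong (σ^ a) pc) (σ^-replicate a n true)) , Triangular-σ^ ns cs pcs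

module _ {k : ℕ} where

  mulMV-∷ : ∀ {m} c (M : Vec (Vec Bool k) m) b bs →
            mulMV (c ∷ M) (b ∷ bs) ≡ (if b then c else zeros k) ⊕ mulMV M bs
  mulMV-∷ c M true bs = refl
  mulMV-∷ c M false bs = sym (⊕-identityˡ (mulMV M bs))

  mulMV-zeros : ∀ {m} (M : Vec (Vec Bool k) m) → mulMV M (zeros m) ≡ zeros k
  mulMV-zeros [] = refl
  mulMV-zeros (c ∷ M) = mulMV-zeros M

  mulMV-⊕ : ∀ {m} (M : Vec (Vec Bool k) m) b b′ → mulMV M (b ⊕ b′) ≡ mulMV M b ⊕ mulMV M b′
  mulMV-⊕ [] [] [] = sym (⊕-self (zeros k))
  mulMV-⊕ (c ∷ M) (x ∷ b) (y ∷ b′) = begin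
    mulMV (c ∷ M) ((x xor y) ∷ (b ⊕ b′))         ≡⟨ mulMV-∷ c M (x xor y) (b ⊕ b′) ⟩
    scale (x xor y) ⊕ mulMV M (b ⊕ b′)           ≡⟨ cong₂ _⊕_ (scale-xor x y) (mulMV-⊕ M b b′) ⟩
    (scale x ⊕ scale y) ⊕ (mulMV M b ⊕ mulMV M b′) ≡⟨ ⊕-interchange (scale x) (scale y) _ _ ⟩
    (scale x ⊕ mulMV M b) ⊕ (scale y ⊕ mulMV M b′) ≡⟨ cong₂ _⊕_ (mulMV-∷ c M x b) (mulMV-∷ c M y b′) ⟨
    mulMV (c ∷ M) (x ∷ b) ⊕ mulMV (c ∷ M) (y ∷ b′) ∎
    where
    scale : Bool → Vec Bool k
    scale b = if b then c else zeros k
    scale-xor : ∀ x y → scale (x xor y) ≡ scale x ⊕ scale y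
    scale-xor false false = sym (⊕-self (zeros k))
    scale-xor false true = sym (⊕-identityˡ c)
    scale-xor true false = sym (⊕-identityʳ c)
    scale-xor true true = sym (⊕-self c)

  mulMV-ext : ∀ {m} (M M′ : Vec (Vec Bool k) m) → (∀ b → mulMV M b ≡ mulMV M′ b) → M ≡ M′
  mulMV-ext [] [] _ = refl
  mulMV-ext {suc m} (c ∷ M) (c′ ∷ M′) h = cong₂ _∷_ c≡c′ (mulMV-ext M M′ (λ b → h (false ∷ b)))
    where
    c≡c′ : c ≡ c′
    c≡c′ = begin
      c                         ≡⟨ ⊕-identityʳ c ⟨
      c ⊕ zeros k               ≡⟨ cong (c ⊕_) (mulMV-zeros M) ⟨
      mulMV (c ∷ M) (true ∷ zeros m)  ≡⟨ h (true ∷ zeros m) ⟩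
      c′ ⊕ mulMV M′ (zeros m)   ≡⟨ cong (c′ ⊕_) (mulMV-zeros M′) ⟩
      c′ ⊕ zeros k              ≡⟨ ⊕-identityʳ c′ ⟩
      c′                        ∎

Δ^-mulMV-triangular : ∀ {n t} (M : Vec (Vec Bool n) t) → Triangular M → ∀ b → Δ^ t (mulMV M b) ≡ zeros n
Δ^-mulMV-triangular [] _ [] = Δ^-zeros 0
Δ^-mulMV-triangular {n} (_∷_ {t} c M) (pc , pM) (b ∷ bs) = begin
  Δ^ (suc t) (mulMV (c ∷ M) (b ∷ bs))                   ≡⟨ cong (Δ^ (suc t)) (mulMV-∷ c M b bs) ⟩
  Δ^ (suc t) ((if b then c else zeros n) ⊕ mulMV M bs)  ≡⟨ Δ^-⊕ (suc t) _ (mulMV M bs) ⟩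
  Δ^ (suc t) (if b then c else zeros n) ⊕ Δ (Δ^ t (mulMV M bs))
      ≡⟨ cong₂ _⊕_ (column b) (cong Δ (Δ^-mulMV-triangular M pM bs)) ⟩
  zeros n ⊕ Δ (zeros n)                                 ≡⟨ ⊕-identityˡ _ ⟩
  Δ (zeros n)                                           ≡⟨ Δ-replicate n false ⟩
  zeros n                                               ∎
  where
  column : ∀ b → Δ^ (suc t) (if b then c else zeros n) ≡ zeros n
  column true = trans (cong Δ pc) (Δ-replicate n true)
  column false = Δ^-zeros (suc t)

mulMV≡zeros⇒≡zeros : ∀ {n m} .{{_ : NonZero n}} (M : Vec (Vec Bool n) m) → Triangular M →
                     ∀ b → mulMV M b ≡ zeros n → b ≡ zeros m
mulMV≡zeros⇒≡zeros [] _ [] _ = refl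
mulMV≡zeros⇒≡zeros (c ∷ M) (_ , pM) (false ∷ b) e = cong (false ∷_) (mulMV≡zeros⇒≡zeros M pM b e)
mulMV≡zeros⇒≡zeros {suc n} (_∷_ {t} c M) (pc , pM) (true ∷ b) e with () ← begin
  ones (suc n)                        ≡⟨ pc ⟨
  Δ^ t c                              ≡⟨ ⊕-identityʳ (Δ^ t c) ⟨
  Δ^ t c ⊕ zeros (suc n)              ≡⟨ cong (Δ^ t c ⊕_) (Δ^-mulMV-triangular M pM b) ⟨
  Δ^ t c ⊕ Δ^ t (mulMV M b)           ≡⟨ Δ^-⊕ t c (mulMV M b) ⟨
  Δ^ t (c ⊕ mulMV M b)                ≡⟨ cong (Δ^ t) e ⟩
  Δ^ t (zeros (suc n))                ≡⟨ Δ^-zeros t ⟩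
  zeros (suc n)                       ∎

double : ∀ {n} → Vec (Vec Bool n) n → Vec (Vec Bool (n + n)) (n + n)
double {n} cols = Vec.map (_++ᵛ zeros n) cols ++ᵛ Vec.map (λ c → c ++ᵛ c) cols

-- The equation passed to cast is irrelevant, so any proof of 2^d + 2^d ≡ 2^(d+1) matches Mcols.
Mcols-suc : ∀ (P : ∀ {k} → Vec (Vec Bool k) k → Set) d → P (double (Mcols d)) → P (Mcols (suc d))
Mcols-suc P d = uncast (cong (2 ^ d +_) (sym (+-identityʳ (2 ^ d)))) (Mcols d)
  where
  uncast : ∀ {n N} (eq : n + n ≡ N) (cols : Vec (Vec Bool n) n) → P (double cols) →
           P (Vec.cast eq (Vec.map (λ c → Vec.cast eq (c ++ᵛ zeros n)) cols ++ᵛ Vec.map (λ c → Vec.cast eq (c ++ᵛ c)) cols))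
  uncast refl cols = subst P (sym (trans (cast-is-id refl _)
    (cong₂ _++ᵛ_ (Vec.map-cong (λ c → cast-is-id refl _) cols) (Vec.map-cong (λ c → cast-is-id refl _) cols))))

Triangular-double : ∀ e {cols : Vec (Vec Bool (2 ^ e)) (2 ^ e)} → Triangular cols → Triangular (double cols)
Triangular-double e {cols} p =
  Columns-++ (Vec.map _ cols) (Vec.map _ cols) (Columns-map _ padded cols p) (Columns-map _ doubled cols p)
  where
  n = 2 ^ e
  doubled : ∀ t c → Δ^ t c ≡ ones n → Δ^ t (c ++ᵛ c) ≡ ones (n + n)
  doubled t c pc = begin
    Δ^ t (c ++ᵛ c)             ≡⟨ Δ^-++-self t c ⟩
    Δ^ t c ++ᵛ Δ^ t c          ≡⟨ cong (λ u → u ++ᵛ u) pc ⟩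
    ones n ++ᵛ ones n          ≡⟨ ++-replicateᵛ n n true ⟩
    ones (n + n)               ∎
  padded : ∀ t c → Δ^ t c ≡ ones n → Δ^ (t + n) (c ++ᵛ zeros n) ≡ ones (n + n)
  padded t c pc = begin
    Δ^ (t + n) (c ++ᵛ zeros n)             ≡⟨ Δ^-+ t n _ ⟩
    Δ^ t (Δ^ n (c ++ᵛ zeros n))            ≡⟨ cong (Δ^ t) (Δ^-halves e c (zeros n)) ⟩
    Δ^ t ((c ⊕ zeros n) ++ᵛ (c ⊕ zeros n)) ≡⟨ cong (λ u → Δ^ t (u ++ᵛ u)) (⊕-identityʳ c) ⟩
    Δ^ t (c ++ᵛ c)                         ≡⟨ doubled t c pc ⟩
    ones (n + n)                           ∎

HeadOneTrailingZeros-double : ∀ {n} {cols : Vec (Vec Bool n) n} → Columns HeadOneTrailingZeros cols →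
                              Columns HeadOneTrailingZeros (double cols)
HeadOneTrailingZeros-double {n} {cols} p =
  Columns-++ (Vec.map _ cols) (Vec.map _ cols) (Columns-map _ padded cols p) (Columns-map _ doubled cols p)
  where
  R : ℕ → List Bool
  R t = List.replicate t false
  padded : ∀ t (c : Vec Bool n) → HeadOneTrailingZeros t c → HeadOneTrailingZeros (t + n) (c ++ᵛ zeros n)
  padded t c (s , e) = s , (begin
    toList (c ++ᵛ zeros n)               ≡⟨ Vec.toList-++ c (zeros n) ⟩
    toList c ++ toList (zeros n)         ≡⟨ cong₂ _++_ e (Vec.toList-replicate n false) ⟩
    (true ∷ s ++ R t) ++ R n             ≡⟨ cong (true ∷_) (List.++-assoc s (R t) (R n)) ⟩
    true ∷ s ++ (R t ++ R n)             ≡⟨ cong (λ r → true ∷ s ++ r) (++-replicate t n false) ⟩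
    true ∷ s ++ R (t + n)                ∎)
  doubled : ∀ t (c : Vec Bool n) → HeadOneTrailingZeros t c → HeadOneTrailingZeros t (c ++ᵛ c)
  doubled t c (s , e) = s ++ R t ++ true ∷ s , (begin
    toList (c ++ᵛ c)                             ≡⟨ Vec.toList-++ c c ⟩
    toList c ++ toList c                         ≡⟨ cong (λ l → l ++ l) e ⟩
    true ∷ (s ++ R t) ++ (true ∷ s ++ R t)       ≡⟨ cong (true ∷_) (List.++-assoc s (R t) _) ⟩
    true ∷ s ++ (R t ++ (true ∷ s) ++ R t)       ≡⟨ cong (λ l → true ∷ s ++ l) (List.++-assoc (R t) (true ∷ s) (R t)) ⟨
    true ∷ s ++ ((R t ++ true ∷ s) ++ R t)       ≡⟨ cong (true ∷_) (List.++-assoc s (R t ++ true ∷ s) (R t)) ⟨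
    true ∷ (s ++ R t ++ true ∷ s) ++ R t         ∎)

Mcols-triangular : ∀ d → Triangular (Mcols d)
Mcols-triangular zero = refl , tt
Mcols-triangular (suc d) = Mcols-suc Triangular d (Triangular-double d (Mcols-triangular d))

Mcols-shape : ∀ d → Columns HeadOneTrailingZeros (Mcols d)
Mcols-shape zero = ([] , refl) , tt
Mcols-shape (suc d) = Mcols-suc (Columns HeadOneTrailingZeros) d (HeadOneTrailingZeros-double (Mcols-shape d))

leadingZeros : List Bool → ℕ
leadingZeros [] = 0
leadingZeros (true ∷ _) = 0
leadingZeros (false ∷ l) = suc (leadingZeros l)

leadingZeros-σ^ : ∀ {n t a} (c : Vec Bool n) → HeadOneTrailingZeros t c → a ≤ t → leadingZeros (toList (σ^ a c)) ≡ a
leadingZeros-σ^ {t = t} {a} c (s , e) a≤t = begin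
  leadingZeros (toList (σ^ a c))                      ≡⟨ cong (λ k → leadingZeros (toList (σ^ k c))) (List.length-replicate a) ⟨
  leadingZeros (toList (σ^ (length (R a)) c))         ≡⟨ cong leadingZeros (toList-σ^ c (true ∷ s ++ R r) (R a) split) ⟩
  leadingZeros (R a ++ true ∷ s ++ R r)               ≡⟨ leadingZeros-replicate a ⟩
  a                                                   ∎
  where
  R : ℕ → List Bool
  R k = List.replicate k false
  r = t ∸ a
  split : toList c ≡ (true ∷ s ++ R r) ++ R a
  split = begin
    toList c                       ≡⟨ e ⟩
    true ∷ s ++ R t                ≡⟨ cong (λ k → true ∷ s ++ R k) (trans (sym (m+[n∸m]≡n a≤t)) (+-comm a r)) ⟩
    true ∷ s ++ R (r + a)          ≡⟨ cong (λ l → true ∷ s ++ l) (++-replicate r a false) ⟨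
    true ∷ s ++ (R r ++ R a)       ≡⟨ cong (true ∷_) (List.++-assoc s (R r) (R a)) ⟨
    (true ∷ s ++ R r) ++ R a       ∎
  leadingZeros-replicate : ∀ k {l} → leadingZeros (R k ++ true ∷ l) ≡ k
  leadingZeros-replicate zero = refl
  leadingZeros-replicate (suc k) = cong suc (leadingZeros-replicate k)

Admissible-head≤ : ∀ {k} x (xs : Vec ℕ k) → Admissible (x ∷ xs) → x ≤ k
Admissible-head≤ x [] refl = z≤n
Admissible-head≤ x (y ∷ xs) ((_ , x≤1+y) , adm) = ≤-trans x≤1+y (s≤s (Admissible-head≤ y xs adm))

Admissible-tail : ∀ {k} x (xs : Vec ℕ k) → Admissible (x ∷ xs) → Admissible xs
Admissible-tail x [] _ = tt
Admissible-tail x (y ∷ xs) (_ , adm) = adm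

-- The admissibility bound n_i ≤ m - i keeps the shifted leading one of column i from wrapping around.
zipWith-σ^-injective : ∀ {n m} (cols : Vec (Vec Bool n) m) → Columns HeadOneTrailingZeros cols →
                       ∀ ns ns′ → Admissible ns → Admissible ns′ → zipWith σ^ ns cols ≡ zipWith σ^ ns′ cols → ns ≡ ns′
zipWith-σ^-injective [] _ [] [] _ _ _ = refl
zipWith-σ^-injective (c ∷ cols) (pc , pcols) (a ∷ ns) (b ∷ ns′) adm adm′ e = cong₂ _∷_ a≡b
  (zipWith-σ^-injective cols pcols ns ns′ (Admissible-tail a ns adm) (Admissible-tail b ns′ adm′) (Vec.∷-injectiveʳ e))
  where
  a≡b = begin
    a                                  ≡⟨ leadingZeros-σ^ c pc (Admissible-head≤ a ns adm) ⟨
    leadingZeros (toList (σ^ a c))     ≡⟨ cong (leadingZeros ∘ toList) (Vec.∷-injectiveˡ e) ⟩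
    leadingZeros (toList (σ^ b c))     ≡⟨ leadingZeros-σ^ c pc (Admissible-head≤ b ns′ adm′) ⟩
    b                                  ∎

Mshift-injective : ∀ d {ns ns′} → Admissible ns → Admissible ns′ → Mshift d ns ≡ Mshift d ns′ → ns ≡ ns′
Mshift-injective d = zipWith-σ^-injective (Mcols d) (Mcols-shape d) _ _

module _ {A : Set} where

  toList-++-injective : ∀ {n} (u v : Vec A n) {xs ys} → toList u ++ xs ≡ toList v ++ ys → u ≡ v × xs ≡ ys
  toList-++-injective [] [] e = refl , e
  toList-++-injective (a ∷ u) (b ∷ v) e with List.∷-injective e
  ... | refl , e′ with toList-++-injective u v e′
  ...   | refl , xs≡ys = refl , xs≡ys

  concatMap-toList-injective : ∀ {B : Set} {n} (f g : B → Vec A n) ws →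
    List.concatMap (toList ∘ f) ws ≡ List.concatMap (toList ∘ g) ws → ∀ {w} → w ∈ ws → f w ≡ g w
  concatMap-toList-injective f g (v ∷ ws) e (here refl) = proj₁ (toList-++-injective (f v) (g v) e)
  concatMap-toList-injective f g (v ∷ ws) e (there w∈ws) =
    concatMap-toList-injective f g ws (proj₂ (toList-++-injective (f v) (g v) e)) w∈ws

allWords-complete : ∀ m (w : Vec Bool m) → w ∈ allWords m
allWords-complete zero [] = here refl
allWords-complete (suc m) (false ∷ w) = ∈-++⁺ˡ (∈-map⁺ (false ∷_) (allWords-complete m w))
allWords-complete (suc m) (true ∷ w) = ∈-++⁺ʳ (List.map (false ∷_) (allWords m)) (∈-map⁺ (true ∷_) (allWords-complete m w))

-- Reading off the affine map w ↦ M (w ⊕ z) at w = 0 and then at every w.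
necklace-injective : ∀ {k m} (M M′ : Vec (Vec Bool k) m) z z′ → (∀ b → mulMV M b ≡ zeros k → b ≡ zeros m) →
                     necklace M z ≡ necklace M′ z′ → M ≡ M′ × z ≡ z′
necklace-injective {k} {m} M M′ z z′ ker e = M≡M′ , ⊕≡zeros⇒≡ z z′ (ker (z ⊕ z′) M[z⊕z′]≡0)
  where
  affine : ∀ w → mulMV M (w ⊕ z) ≡ mulMV M′ (w ⊕ z′)
  affine w = concatMap-toList-injective (λ w → mulMV M (w ⊕ z)) (λ w → mulMV M′ (w ⊕ z′))
                                        (allWords m) e (allWords-complete m w)
  Mz≡M′z′ : mulMV M z ≡ mulMV M′ z′
  Mz≡M′z′ = begin
    mulMV M z                    ≡⟨ cong (mulMV M) (⊕-identityˡ z) ⟨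
    mulMV M (zeros m ⊕ z)        ≡⟨ affine (zeros m) ⟩
    mulMV M′ (zeros m ⊕ z′)      ≡⟨ cong (mulMV M′) (⊕-identityˡ z′) ⟩
    mulMV M′ z′                  ∎
  linear : ∀ w → mulMV M w ≡ mulMV M′ w
  linear w = ⊕-cancelʳ (mulMV M w) (mulMV M′ w) (mulMV M z) (begin
    mulMV M w ⊕ mulMV M z        ≡⟨ mulMV-⊕ M w z ⟨
    mulMV M (w ⊕ z)              ≡⟨ affine w ⟩
    mulMV M′ (w ⊕ z′)            ≡⟨ mulMV-⊕ M′ w z′ ⟩
    mulMV M′ w ⊕ mulMV M′ z′     ≡⟨ cong (mulMV M′ w ⊕_) Mz≡M′z′ ⟨
    mulMV M′ w ⊕ mulMV M z       ∎)
  M≡M′ : M ≡ M′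
  M≡M′ = mulMV-ext M M′ linear
  M[z⊕z′]≡0 : mulMV M (z ⊕ z′) ≡ zeros k
  M[z⊕z′]≡0 = begin
    mulMV M (z ⊕ z′)             ≡⟨ mulMV-⊕ M z z′ ⟩
    mulMV M z ⊕ mulMV M z′       ≡⟨ cong₂ _⊕_ Mz≡M′z′ (linear z′) ⟩
    mulMV M′ z′ ⊕ mulMV M′ z′    ≡⟨ ⊕-self (mulMV M′ z′) ⟩
    zeros k                      ∎

Mshift-kernel : ∀ d ns b → mulMV (Mshift d ns) b ≡ zeros (2 ^ d) → b ≡ zeros (2 ^ d)
Mshift-kernel d ns = mulMV≡zeros⇒≡zeros {{m^n≢0 2 d}} (Mshift d ns) (Triangular-σ^ ns (Mcols d) (Mcols-triangular d))

allWords-unique : ∀ m → Unique (allWords m)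
allWords-unique zero = [] ∷ []
allWords-unique (suc m) = Unique.++⁺ (Unique.map⁺ Vec.∷-injectiveʳ (allWords-unique m))
                                     (Unique.map⁺ Vec.∷-injectiveʳ (allWords-unique m)) heads-differ
  where
  heads-differ : Disjoint (List.map (false ∷_) (allWords m)) (List.map (true ∷_) (allWords m))
  heads-differ (v∈₀ , v∈₁) with ∈-map⁻ (false ∷_) v∈₀ | ∈-map⁻ (true ∷_) v∈₁
  ... | _ , _ , refl | _ , _ , ()

length-allWords : ∀ m → length (allWords m) ≡ 2 ^ m
length-allWords zero = refl
length-allWords (suc m) = begin
  length (List.map (false ∷_) (allWords m) ++ List.map (true ∷_) (allWords m))
    ≡⟨ List.length-++ (List.map (false ∷_) (allWords m)) ⟩
  length (List.map (false ∷_) (allWords m)) + length (List.map (true ∷_) (allWords m))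
    ≡⟨ cong₂ _+_ (List.length-map (false ∷_) (allWords m)) (List.length-map (true ∷_) (allWords m)) ⟩
  length (allWords m) + length (allWords m)
    ≡⟨ cong (λ l → l + l) (length-allWords m) ⟩
  2 ^ m + 2 ^ m
    ≡⟨ cong (2 ^ m +_) (+-identityʳ (2 ^ m)) ⟨
  2 ^ suc m ∎

length-cartesianProductWith : ∀ {A B C : Set} (f : A → B → C) xs ys →
                              length (cartesianProductWith f xs ys) ≡ length xs * length ys
length-cartesianProductWith f [] ys = refl
length-cartesianProductWith f (x ∷ xs) ys = begin
  length (List.map (f x) ys ++ cartesianProductWith f xs ys)       ≡⟨ List.length-++ (List.map (f x) ys) ⟩
  length (List.map (f x) ys) + length (cartesianProductWith f xs ys)
    ≡⟨ cong₂ _+_ (List.length-map (f x) ys) (length-cartesianProductWith f xs ys) ⟩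
  length ys + length xs * length ys                                ∎

bump : Bool → ℕ → ℕ
bump b n = if b then suc n else n

-- Admissible sequences are exactly the running sums n_i = Σ_{j ≥ i} b_j of bit words.
bitsToShifts : ∀ {k} → Vec Bool k → Vec ℕ (suc k)
bitsToShifts [] = 0 ∷ []
bitsToShifts (b ∷ bs) = bump b (Vec.head (bitsToShifts bs)) ∷ bitsToShifts bs

bitsToShifts-admissible : ∀ {k} (bs : Vec Bool k) → Admissible (bitsToShifts bs)
bitsToShifts-admissible [] = refl
bitsToShifts-admissible (b ∷ bs) with bitsToShifts bs | bitsToShifts-admissible bs
... | y ∷ ys | adm = (n≤bump b , bump≤1+n b) , adm
  where
  n≤bump : ∀ b → y ≤ bump b y
  n≤bump false = ≤-refl
  n≤bump true = n≤1+n y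
  bump≤1+n : ∀ b → bump b y ≤ suc y
  bump≤1+n false = n≤1+n y
  bump≤1+n true = ≤-refl

bitsToShifts-injective : ∀ {k} (bs bs′ : Vec Bool k) → bitsToShifts bs ≡ bitsToShifts bs′ → bs ≡ bs′
bitsToShifts-injective [] [] _ = refl
bitsToShifts-injective (b ∷ bs) (b′ ∷ bs′) e with bitsToShifts-injective bs bs′ (Vec.∷-injectiveʳ e)
... | refl = cong (_∷ bs) (bump-injective b b′ (Vec.∷-injectiveˡ e))
  where
  bump-injective : ∀ {n} b b′ → bump b n ≡ bump b′ n → b ≡ b′
  bump-injective false false _ = refl
  bump-injective false true e = contradiction (sym e) 1+n≢n
  bump-injective true false e = contradiction e 1+n≢n
  bump-injective true true _ = refl

bitsToShifts-surjective : ∀ {k} (ns : Vec ℕ (suc k)) → Admissible ns → Σ (Vec Bool k) λ bs → bitsToShifts bs ≡ ns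
bitsToShifts-surjective (x ∷ []) refl = [] , refl
bitsToShifts-surjective (x ∷ y ∷ ys) ((y≤x , x≤1+y) , adm) with bitsToShifts-surjective (y ∷ ys) adm
... | bs , e with bit
  where
  bit : Σ Bool λ b → bump b y ≡ x
  bit with m≤n⇒m<n∨m≡n x≤1+y
  ... | inj₁ (s≤s x≤y) = false , ≤-antisym y≤x x≤y
  ... | inj₂ x≡1+y = true , sym x≡1+y
... | b , bump≡x = b ∷ bs , cong₂ _∷_ (trans (cong (bump b ∘ Vec.head) e) bump≡x) e

enumerate-admissible-image : ∀ {A : Set} m .{{_ : NonZero m}} (f : Vec ℕ m → Vec Bool m → A) →
  (∀ ns ns′ z z′ → Admissible ns → Admissible ns′ → f ns z ≡ f ns′ z′ → ns ≡ ns′ × z ≡ z′) →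
  Σ (List A) λ L → Unique L × length L ≡ 2 ^ (2 * m ∸ 1) ×
    ((w : A) → (w ∈ L) ⇔ (Σ (Vec ℕ m) λ ns → Σ (Vec Bool m) λ z → Admissible ns × f ns z ≡ w))
enumerate-admissible-image (suc k) f inj = L , unique , size , (λ w → mk⇔ sound (complete w))
  where
  g : Vec Bool k → Vec Bool (suc k) → _
  g bs = f (bitsToShifts bs)
  L = cartesianProductWith g (allWords k) (allWords (suc k))
  unique : Unique L
  unique = Unique.cartesianProductWith⁺ g g-injective (allWords-unique k) (allWords-unique (suc k))
    where
    g-injective : ∀ {bs bs′ z z′} → g bs z ≡ g bs′ z′ → bs ≡ bs′ × z ≡ z′
    g-injective {bs} {bs′} {z} {z′} e with inj _ _ z z′ (bitsToShifts-admissible bs) (bitsToShifts-admissible bs′) e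
    ... | ns≡ns′ , z≡z′ = bitsToShifts-injective bs bs′ ns≡ns′ , z≡z′
  size : length L ≡ 2 ^ (2 * suc k ∸ 1)
  size = begin
    length L                          ≡⟨ length-cartesianProductWith g (allWords k) (allWords (suc k)) ⟩
    length (allWords k) * length (allWords (suc k)) ≡⟨ cong₂ _*_ (length-allWords k) (length-allWords (suc k)) ⟩
    2 ^ k * 2 ^ suc k                 ≡⟨ ^-distribˡ-+-* 2 k (suc k) ⟨
    2 ^ (k + suc k)                   ≡⟨ cong (λ j → 2 ^ (k + j)) (+-identityʳ (suc k)) ⟨
    2 ^ (2 * suc k ∸ 1)               ∎
  sound : ∀ {w} → w ∈ L → Σ _ λ ns → Σ _ λ z → Admissible ns × f ns z ≡ w
  sound w∈L with ∈-cartesianProductWith⁻ g (allWords k) (allWords (suc k)) w∈L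
  ... | bs , z , _ , _ , refl = bitsToShifts bs , z , bitsToShifts-admissible bs , refl
  complete : ∀ w → (Σ _ λ ns → Σ _ λ z → Admissible ns × f ns z ≡ w) → w ∈ L
  complete w (ns , z , adm , refl) with bitsToShifts-surjective ns adm
  ... | bs , refl = ∈-cartesianProductWith⁺ g (allWords-complete k bs) (allWords-complete (suc k) z)

necklace-Mshift-injective : ∀ d ns ns′ z z′ → necklace (Mshift d ns) z ≡ necklace (Mshift d ns′) z′ →
                            Mshift d ns ≡ Mshift d ns′ × z ≡ z′
necklace-Mshift-injective d ns ns′ z z′ = necklace-injective (Mshift d ns) (Mshift d ns′) z z′ (Mshift-kernel d ns)

lemma9 : (d : ℕ) →
    ((ns ns′ : Vec ℕ (2 ^ d)) (z z′ : Vec Bool (2 ^ d)) →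
      Admissible ns → Admissible ns′ →
      necklace (Mshift d ns) z ≡ necklace (Mshift d ns′) z′ →
      Mshift d ns ≡ Mshift d ns′ × z ≡ z′)
    × Σ (List (List Bool)) (λ L →
        Unique L × length L ≡ 2 ^ (2 * 2 ^ d ∸ 1) ×
        ((w : List Bool) → (w ∈ L) ⇔ IsAffineNecklace d w))
lemma9 d =
  (λ ns ns′ z z′ _ _ → necklace-Mshift-injective d ns ns′ z z′) ,
  enumerate-admissible-image (2 ^ d) {{m^n≢0 2 d}} (λ ns z → necklace (Mshift d ns) z) injective
  where
  injective : ∀ ns ns′ z z′ → Admissible ns → Admissible ns′ →
              necklace (Mshift d ns) z ≡ necklace (Mshift d ns′) z′ → ns ≡ ns′ × z ≡ z′
  injective ns ns′ z z′ adm adm′ e with necklace-Mshift-injective d ns ns′ z z′ e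
  ... | M≡M′ , z≡z′ = Mshift-injective d adm adm′ M≡M′ , z≡z′
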